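{- Let $\Phi$ be a second-order constraint problem. (1) Soundness: if $\mathcal J$ is an interpretation (of the index symbols together with the skolem functions) that is a model of $\mathrm{sk}(\Phi)$, then $(\mathcal J,\kappa_{\mathrm{sk}})$ is a model of $\Phi$. (2) Completeness: if $(\mathcal J,\kappa)$ is a model of $\Phi$, then $\mathcal J'$ is a model of $\mathrm{sk}(\Phi)$ for some extension $\mathcal J'$ of $\mathcal J$ to the skolem functions.
   Context: Index terms are built from index variables $i$ and index symbols $g$ (with arities, including $0$, unary $\mathsf s$, binary $+$); an interpretation $\mathcal J$ maps each $k$-ary index symbol to a total weakly monotone function $\mathbb N^k\to\mathbb N$ ($0,\mathsf s,+$ standard), and for index terms $a\le_{\mathcal J}b$ means the value of $a$ is at most that of $b$ under every assignment of naturals to index variables. Let $\mathcal S$ be a countably infinite set of second-order index variables; second-order index terms are $\mathfrak a ::= i\mid\alpha\mid g(\mathfrak a_1,\dots,\mathfrak a_k)$ ($\alpha\in\mathcal S$); $\mathrm{Var}(\mathfrak a)$ denotes its ordinary index variables. A second-order constraint problem (SOCP) $\Phi$ is a set of inequality constraints $\mathfrak a\le\mathfrak b$ and occurrence constraints $i\not\leadsto\alpha$. $(\mathcal J,\kappa)$, with $\kappa$ mapping second-order variables to index terms free of second-order variables, is a model of $\Phi$ if $\mathfrak a\kappa\le_{\mathcal J}\mathfrak b\kappa$ for every $(\mathfrak a\le\mathfrak b)\in\Phi$ and $i\notin\mathrm{Var}(\kappa(\alpha))$ for every $(i\not\leadsto\alpha)\in\Phi$. A first-order constraint problem (a set of inequalities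 between index terms without second-order variables) has model $\mathcal J$ if all its inequalities hold under $\le_{\mathcal J}$. Skolemization: for each second-order variable $\beta$ of $\Phi$ let $\mathrm{SV}'(\beta)$ be the least sets with: for every $(\mathfrak a\le\mathfrak b)\in\Phi$ where $\beta$ occurs in $\mathfrak b$, $\mathrm{Var}(\mathfrak a)\subseteq\mathrm{SV}'(\beta)$ and $\mathrm{SV}'(\alpha)\subseteq\mathrm{SV}'(\beta)$ for each second-order $\alpha$ in $\mathfrak a$; and $\mathrm{SV}(\beta)=\mathrm{SV}'(\beta)\setminus\{i\mid(i\not\leadsto\beta)\in\Phi\}$. For each second-order variable $\alpha$ of $\Phi$ let $f_\alpha$ be a fresh index symbol (skolem function) of arity $|\mathrm{SV}(\alpha)|$, and let $\kappa_{\mathrm{sk}}(\alpha)=f_\alpha(i_1,\dots,i_k)$ where $\mathrm{SV}(\alpha)=\{i_1,\dots,i_k\}$. Then $\mathrm{sk}(\Phi)=\{\mathfrak a\kappa_{\mathrm{sk}}\le\mathfrak b\kappa_{\mathrm{sk}}\mid(\mathfrak a\le\mathfrak b)\in\Phi\}$, a first-order constraint problem. -}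

module Defs where

open import Data.Nat using (ℕ; zero; suc; _+_; _≤_)
open import Data.Empty using (⊥; ⊥-elim)
open import Data.Product using (_×_; _,_; Σ; ∃)
open import Data.Sum using (_⊎_; inj₁; inj₂; [_,_]′)
open import Data.List using (List; []; _∷_; length)
open import Data.List.Membership.Propositional using (_∈_)
open import Data.List.Relation.Unary.Unique.Propositional using (Unique)
open import Data.Vec using (Vec; []; _∷_; fromList)
import Data.Vec.Membership.Propositional as VM
open import Data.Vec.Relation.Binary.Pointwise.Inductive using (Pointwise)
open import Relation.Binary.PropositionalEquality using (_≡_)
open import Relation.Nullary using (¬_)
open import Function.Bundles using (_⇔_)

-- Terms over variables of type S for second-order variables:
--   S = ℕ : second-order index terms;  S = ⊥ : ordinary index terms.
data Term (F : Set) (ar : F → ℕ) (S : Set) : Set where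
  var  : ℕ → Term F ar S
  sov  : S → Term F ar S
  zer  : Term F ar S
  suc' : Term F ar S → Term F ar S
  plus : Term F ar S → Term F ar S → Term F ar S
  app  : (g : F) → Vec (Term F ar S) (ar g) → Term F ar S

module _ {F : Set} {ar : F → ℕ} where

  mutual
    subst : {S T : Set} → (S → Term F ar T) → Term F ar S → Term F ar T
    subst κ (var i) = var i
    subst κ (sov α) = κ α
    subst κ zer = zer
    subst κ (suc' a) = suc' (subst κ a)
    subst κ (plus a b) = plus (subst κ a) (subst κ b)
    subst κ (app g as) = app g (substs κ as)

    substs : {S T : Set} {n : ℕ} → (S → Term F ar T) → Vec (Term F ar S) n → Vec (Term F ar T) n
    substs κ [] = []
    substs κ (a ∷ as) = subst κ a ∷ substs κ as

  data OccVar {S : Set} (i : ℕ) : Term F ar S → Set where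
    here  : OccVar i (var i)
    suc'  : ∀ {a} → OccVar i a → OccVar i (suc' a)
    plusˡ : ∀ {a b} → OccVar i a → OccVar i (plus a b)
    plusʳ : ∀ {a b} → OccVar i b → OccVar i (plus a b)
    app   : ∀ {g as a} → a VM.∈ as → OccVar i a → OccVar i (app g as)

  data OccSO (α : ℕ) : Term F ar ℕ → Set where
    here  : OccSO α (sov α)
    suc'  : ∀ {a} → OccSO α a → OccSO α (suc' a)
    plusˡ : ∀ {a b} → OccSO α a → OccSO α (plus a b)
    plusʳ : ∀ {a b} → OccSO α b → OccSO α (plus a b)
    app   : ∀ {g as a} → a VM.∈ as → OccSO α a → OccSO α (app g as)

  data Constraint : Set where
    _≤c_ : Term F ar ℕ → Term F ar ℕ → Constraint
    _↝̸_  : ℕ → ℕ → Constraint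

  SOCP : Set
  SOCP = List Constraint

  FOCP : Set
  FOCP = List (Term F ar ⊥ × Term F ar ⊥)

  -- SV'(β) as the least set closed under the rules:  SV' Φ i β  means i ∈ SV'(β)
  data SV' (Φ : SOCP) : ℕ → ℕ → Set where
    base : ∀ {a b i β} → (a ≤c b) ∈ Φ → OccSO β b → OccVar i a → SV' Φ i β
    step : ∀ {a b i α β} → (a ≤c b) ∈ Φ → OccSO β b → OccSO α a → SV' Φ i α → SV' Φ i β

  SV : SOCP → ℕ → ℕ → Set
  SV Φ i β = SV' Φ i β × ¬ ((i ↝̸ β) ∈ Φ)

  IsSVEnum : SOCP → (ℕ → List ℕ) → Set
  IsSVEnum Φ sv = ∀ β → Unique (sv β) × (∀ i → (i ∈ sv β) ⇔ SV Φ i β)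

record Interp (F : Set) (ar : F → ℕ) : Set where
  field
    fun  : (g : F) → Vec ℕ (ar g) → ℕ
    mono : ∀ g (u v : Vec ℕ (ar g)) → Pointwise _≤_ u v → fun g u ≤ fun g v
open Interp public

module _ {F : Set} {ar : F → ℕ} where

  mutual
    eval : Interp F ar → (ℕ → ℕ) → Term F ar ⊥ → ℕ
    eval J ρ (var i) = ρ i
    eval J ρ (sov ())
    eval J ρ zer = zero
    eval J ρ (suc' a) = suc (eval J ρ a)
    eval J ρ (plus a b) = eval J ρ a + eval J ρ b
    eval J ρ (app g as) = fun J g (evals J ρ as)

    evals : {n : ℕ} → Interp F ar → (ℕ → ℕ) → Vec (Term F ar ⊥) n → Vec ℕ n
    evals J ρ [] = []
    evals J ρ (a ∷ as) = eval J ρ a ∷ evals J ρ as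

  _≤[_]_ : Term F ar ⊥ → Interp F ar → Term F ar ⊥ → Set
  a ≤[ J ] b = ∀ (ρ : ℕ → ℕ) → eval J ρ a ≤ eval J ρ b

  IsModelSO : Interp F ar → (ℕ → Term F ar ⊥) → SOCP → Set
  IsModelSO J κ Φ =
    (∀ a b → (a ≤c b) ∈ Φ → subst κ a ≤[ J ] subst κ b) ×
    (∀ i α → (i ↝̸ α) ∈ Φ → ¬ OccVar i (κ α))

  IsModelFO : Interp F ar → FOCP → Set
  IsModelFO J Ψ = ∀ a b → (a , b) ∈ Ψ → a ≤[ J ] b

-- Extended signature: original symbols plus a skolem symbol f_α for every
-- second-order variable α, of arity length (sv α) = |SV(α)|.
module _ {F : Set} (ar : F → ℕ) (sv : ℕ → List ℕ) where

  SkSym : Set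
  SkSym = F ⊎ ℕ

  skAr : SkSym → ℕ
  skAr = [ ar , (λ α → length (sv α)) ]′

module _ {F : Set} {ar : F → ℕ} (sv : ℕ → List ℕ) where

  mutual
    lift : {S : Set} → Term F ar S → Term (SkSym ar sv) (skAr ar sv) S
    lift (var i) = var i
    lift (sov α) = sov α
    lift zer = zer
    lift (suc' a) = suc' (lift a)
    lift (plus a b) = plus (lift a) (lift b)
    lift (app g as) = app (inj₁ g) (lifts as)

    lifts : {S : Set} {n : ℕ} → Vec (Term F ar S) n → Vec (Term (SkSym ar sv) (skAr ar sv) S) n
    lifts [] = []
    lifts (a ∷ as) = lift a ∷ lifts as

  liftC : Constraint {F} {ar} → Constraint {SkSym ar sv} {skAr ar sv}
  liftC (a ≤c b) = lift a ≤c lift b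
  liftC (i ↝̸ α) = i ↝̸ α

  liftΦ : SOCP {F} {ar} → SOCP {SkSym ar sv} {skAr ar sv}
  liftΦ = Data.List.map liftC

  κsk : ℕ → Term (SkSym ar sv) (skAr ar sv) ⊥
  κsk α = app (inj₂ α) (Data.Vec.map var (fromList (sv α)))

  sk : SOCP {F} {ar} → FOCP {SkSym ar sv} {skAr ar sv}
  sk [] = []
  sk ((a ≤c b) ∷ Φ) = (subst κsk (lift a) , subst κsk (lift b)) ∷ sk Φ
  sk ((i ↝̸ α) ∷ Φ) = sk Φ

  Extends : Interp (SkSym ar sv) (skAr ar sv) → Interp F ar → Set
  Extends J' J = ∀ g v → fun J' (inj₁ g) v ≡ fun J g v

module Submission where

-- Soundness is direct: every constraint of sk(Φ) is a constraint of Φ with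
-- κ_sk substituted, and κ_sk(α) = f_α(SV(α)) only mentions variables i with
-- i ∈ SV(α), which excludes every i with (i ↝̸ α) ∈ Φ.
--
-- Completeness: given a model (J, κ) we interpret f_α(v₁,…,v_k) as κ(α)
-- evaluated with SV(α) = {i₁,…,i_k} set to v and every other variable set
-- to 0.  Thus under ρ the skolem term f_α(SV(α)) denotes κ(α) evaluated in
-- ρ restricted to SV(α).  For a constraint a ≤ b of Φ let D(a) be the set of
-- variables a depends on, Var(a) ∪ ⋃{SV(α) | α occurs in a}, and σ the
-- restriction of ρ to D(a).  By monotonicity of evaluation, the left side
-- under ρ is at most aκ under σ, which is at most bκ under σ since (J, κ) is
-- a model, which in turn is at most the right side under ρ: here one uses
-- that D(a) ⊆ SV'(β) for every β occurring in b, by the closure rules of SV'.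

open import Defs
open import Data.Nat using (ℕ; zero; suc; _+_; _≤_; z≤n; s≤s; _≟_)
open import Data.Nat.Properties using (≤-refl; ≤-reflexive; ≤-antisym; +-mono-≤; module ≤-Reasoning)
open import Data.Empty using (⊥; ⊥-elim)
open import Data.Product using (_×_; Σ; ∃; _,_; proj₁; proj₂)
open import Data.Sum using (_⊎_; inj₁; inj₂; [_,_]′)
open import Data.List using (List; []; _∷_; _++_; length)
open import Data.List.Membership.Propositional using (_∈_; _∉_)
open import Data.List.Membership.Propositional.Properties using (∈-++⁺ˡ; ∈-++⁺ʳ; ∈-++⁻)
open import Data.List.Membership.DecPropositional _≟_ using (_∈?_)
open import Data.List.Relation.Unary.Any using (here; there)
open import Data.Vec using (Vec; []; _∷_; fromList)
import Data.Vec as Vec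
import Data.Vec.Relation.Unary.Any as VAny
import Data.Vec.Membership.Propositional as VM
open import Data.Vec.Relation.Binary.Pointwise.Inductive using (Pointwise; []; _∷_)
open import Relation.Binary.PropositionalEquality using (_≡_; refl; sym; trans; cong; cong₂)
open import Relation.Nullary using (¬_; yes; no)
open import Function using (_∘_)
open import Function.Bundles using (Equivalence)

module _ {F : Set} {ar : F → ℕ} where

  mutual
    evalSO : Interp F ar → (ℕ → ℕ) → (ℕ → ℕ) → Term F ar ℕ → ℕ
    evalSO J ρ η (var i) = ρ i
    evalSO J ρ η (sov α) = η α
    evalSO J ρ η zer = zero
    evalSO J ρ η (suc' a) = suc (evalSO J ρ η a)
    evalSO J ρ η (plus a b) = evalSO J ρ η a + evalSO J ρ η b
    evalSO J ρ η (app g as) = fun J g (evalSOs J ρ η as)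

    evalSOs : {n : ℕ} → Interp F ar → (ℕ → ℕ) → (ℕ → ℕ) → Vec (Term F ar ℕ) n → Vec ℕ n
    evalSOs J ρ η [] = []
    evalSOs J ρ η (a ∷ as) = evalSO J ρ η a ∷ evalSOs J ρ η as

  mutual
    eval-subst : (J : Interp F ar) (ρ : ℕ → ℕ) (κ : ℕ → Term F ar ⊥) (a : Term F ar ℕ) →
      eval J ρ (subst κ a) ≡ evalSO J ρ (λ α → eval J ρ (κ α)) a
    eval-subst J ρ κ (var i) = refl
    eval-subst J ρ κ (sov α) = refl
    eval-subst J ρ κ zer = refl
    eval-subst J ρ κ (suc' a) = cong suc (eval-subst J ρ κ a)
    eval-subst J ρ κ (plus a b) = cong₂ _+_ (eval-subst J ρ κ a) (eval-subst J ρ κ b)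
    eval-subst J ρ κ (app g as) = cong (fun J g) (evals-subst J ρ κ as)

    evals-subst : {n : ℕ} (J : Interp F ar) (ρ : ℕ → ℕ) (κ : ℕ → Term F ar ⊥) (as : Vec (Term F ar ℕ) n) →
      evals J ρ (substs κ as) ≡ evalSOs J ρ (λ α → eval J ρ (κ α)) as
    evals-subst J ρ κ [] = refl
    evals-subst J ρ κ (a ∷ as) = cong₂ _∷_ (eval-subst J ρ κ a) (evals-subst J ρ κ as)

  mutual
    eval-mono : (J : Interp F ar) {ρ ρ' : ℕ → ℕ} (t : Term F ar ⊥) →
      (∀ {j} → OccVar j t → ρ j ≤ ρ' j) → eval J ρ t ≤ eval J ρ' t
    eval-mono J (var i) h = h here
    eval-mono J (sov ())
    eval-mono J zer h = z≤n
    eval-mono J (suc' a) h = s≤s (eval-mono J a (h ∘ suc'))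
    eval-mono J (plus a b) h = +-mono-≤ (eval-mono J a (h ∘ plusˡ)) (eval-mono J b (h ∘ plusʳ))
    eval-mono J (app g as) h = mono J g _ _ (evals-mono J as (λ t∈as → h ∘ app t∈as))

    evals-mono : {n : ℕ} (J : Interp F ar) {ρ ρ' : ℕ → ℕ} (as : Vec (Term F ar ⊥) n) →
      (∀ {j t} → t VM.∈ as → OccVar j t → ρ j ≤ ρ' j) → Pointwise _≤_ (evals J ρ as) (evals J ρ' as)
    evals-mono J [] h = []
    evals-mono J (a ∷ as) h = eval-mono J a (h (VAny.here refl)) ∷ evals-mono J as (h ∘ VAny.there)

  mutual
    evalSO-mono : (J : Interp F ar) {ρ ρ' η η' : ℕ → ℕ} (t : Term F ar ℕ) →
      (∀ {j} → OccVar j t → ρ j ≤ ρ' j) → (∀ {α} → OccSO α t → η α ≤ η' α) →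
      evalSO J ρ η t ≤ evalSO J ρ' η' t
    evalSO-mono J (var i) h k = h here
    evalSO-mono J (sov α) h k = k here
    evalSO-mono J zer h k = z≤n
    evalSO-mono J (suc' a) h k = s≤s (evalSO-mono J a (h ∘ suc') (k ∘ suc'))
    evalSO-mono J (plus a b) h k =
      +-mono-≤ (evalSO-mono J a (h ∘ plusˡ) (k ∘ plusˡ)) (evalSO-mono J b (h ∘ plusʳ) (k ∘ plusʳ))
    evalSO-mono J (app g as) h k =
      mono J g _ _ (evalSOs-mono J as (λ t∈as → h ∘ app t∈as) (λ t∈as → k ∘ app t∈as))

    evalSOs-mono : {n : ℕ} (J : Interp F ar) {ρ ρ' η η' : ℕ → ℕ} (as : Vec (Term F ar ℕ) n) →
      (∀ {j t} → t VM.∈ as → OccVar j t → ρ j ≤ ρ' j) → (∀ {α t} → t VM.∈ as → OccSO α t → η α ≤ η' α) →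
      Pointwise _≤_ (evalSOs J ρ η as) (evalSOs J ρ' η' as)
    evalSOs-mono J [] h k = []
    evalSOs-mono J (a ∷ as) h k =
      evalSO-mono J a (h (VAny.here refl)) (k (VAny.here refl)) ∷ evalSOs-mono J as (h ∘ VAny.there) (k ∘ VAny.there)

  evalSO-congη : (J : Interp F ar) (ρ : ℕ → ℕ) {η η' : ℕ → ℕ} (a : Term F ar ℕ) →
    (∀ α → η α ≡ η' α) → evalSO J ρ η a ≡ evalSO J ρ η' a
  evalSO-congη J ρ a η≡η' = ≤-antisym
    (evalSO-mono J a (λ _ → ≤-refl) (λ {α} _ → ≤-reflexive (η≡η' α)))
    (evalSO-mono J a (λ _ → ≤-refl) (λ {α} _ → ≤-reflexive (sym (η≡η' α))))

  evals-vars : (J : Interp F ar) (ρ : ℕ → ℕ) (xs : List ℕ) →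
    evals J ρ (Vec.map var (fromList xs)) ≡ Vec.map ρ (fromList xs)
  evals-vars J ρ [] = refl
  evals-vars J ρ (x ∷ xs) = cong (ρ x ∷_) (evals-vars J ρ xs)

module _ {F : Set} {ar : F → ℕ} (sv : ℕ → List ℕ)
         {J' : Interp (SkSym ar sv) (skAr ar sv)} {J : Interp F ar} (ext : Extends sv J' J) where

  mutual
    evalSO-lift : (ρ η : ℕ → ℕ) (a : Term F ar ℕ) → evalSO J' ρ η (lift sv a) ≡ evalSO J ρ η a
    evalSO-lift ρ η (var i) = refl
    evalSO-lift ρ η (sov α) = refl
    evalSO-lift ρ η zer = refl
    evalSO-lift ρ η (suc' a) = cong suc (evalSO-lift ρ η a)
    evalSO-lift ρ η (plus a b) = cong₂ _+_ (evalSO-lift ρ η a) (evalSO-lift ρ η b)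
    evalSO-lift ρ η (app g as) = trans (cong (fun J' (inj₁ g)) (evalSOs-lift ρ η as)) (ext g _)

    evalSOs-lift : {n : ℕ} (ρ η : ℕ → ℕ) (as : Vec (Term F ar ℕ) n) →
      evalSOs J' ρ η (lifts sv as) ≡ evalSOs J ρ η as
    evalSOs-lift ρ η [] = refl
    evalSOs-lift ρ η (a ∷ as) = cong₂ _∷_ (evalSO-lift ρ η a) (evalSOs-lift ρ η as)

-- The environment giving the variables xs the values v (first occurrence
-- wins) and every other variable the value 0.
assign : (xs : List ℕ) → Vec ℕ (length xs) → ℕ → ℕ
assign [] [] j = 0
assign (x ∷ xs) (v ∷ vs) j with j ≟ x
... | yes _ = v
... | no _ = assign xs vs j

assign-mono : (xs : List ℕ) {u v : Vec ℕ (length xs)} → Pointwise _≤_ u v → ∀ j → assign xs u j ≤ assign xs v j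
assign-mono [] [] j = ≤-refl
assign-mono (x ∷ xs) (u≤v ∷ us≤vs) j with j ≟ x
... | yes _ = u≤v
... | no _ = assign-mono xs us≤vs j

restrict : List ℕ → (ℕ → ℕ) → ℕ → ℕ
restrict xs ρ = assign xs (Vec.map ρ (fromList xs))

restrict-∈ : (ρ : ℕ → ℕ) (xs : List ℕ) {j : ℕ} → j ∈ xs → restrict xs ρ j ≡ ρ j
restrict-∈ ρ (x ∷ xs) {j} j∈ with j ≟ x
... | yes refl = refl
restrict-∈ ρ (x ∷ xs) (here refl) | no j≢x = ⊥-elim (j≢x refl)
restrict-∈ ρ (x ∷ xs) (there j∈) | no _ = restrict-∈ ρ xs j∈

restrict-∉ : (ρ : ℕ → ℕ) (xs : List ℕ) {j : ℕ} → j ∉ xs → restrict xs ρ j ≡ 0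
restrict-∉ ρ [] j∉ = refl
restrict-∉ ρ (x ∷ xs) {j} j∉ with j ≟ x
... | yes refl = ⊥-elim (j∉ (here refl))
... | no _ = restrict-∉ ρ xs (j∉ ∘ there)

restrict-≤ : (ρ : ℕ → ℕ) (xs : List ℕ) (j : ℕ) → restrict xs ρ j ≤ ρ j
restrict-≤ ρ xs j with j ∈? xs
... | yes j∈ = ≤-reflexive (restrict-∈ ρ xs j∈)
... | no j∉ rewrite restrict-∉ ρ xs j∉ = z≤n

restrict-⊆ : (ρ : ℕ → ℕ) (xs ys : List ℕ) {j : ℕ} → (j ∈ xs → j ∈ ys) → restrict xs ρ j ≤ restrict ys ρ j
restrict-⊆ ρ xs ys {j} xs⊆ys with j ∈? xs
... | yes j∈ = ≤-reflexive (trans (restrict-∈ ρ xs j∈) (sym (restrict-∈ ρ ys (xs⊆ys j∈))))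
... | no j∉ rewrite restrict-∉ ρ xs j∉ = z≤n

module _ {F : Set} {ar : F → ℕ} (sv : ℕ → List ℕ) where

  κsk-vars : ∀ {i} α → OccVar i (κsk {F} {ar} sv α) → i ∈ sv α
  κsk-vars α (app t∈ o) = vars-of-list (sv α) t∈ o
    where
      vars-of-list : ∀ {i t} (xs : List ℕ) → t VM.∈ Vec.map var (fromList xs) → OccVar i t → i ∈ xs
      vars-of-list (x ∷ xs) (VAny.here refl) here = here refl
      vars-of-list (x ∷ xs) (VAny.there t∈) o = there (vars-of-list xs t∈ o)

  skolemise : Term F ar ℕ → Term (SkSym ar sv) (skAr ar sv) ⊥
  skolemise a = subst (κsk sv) (lift sv a)

  mutual
    deps : Term F ar ℕ → List ℕ
    deps (var i) = i ∷ []
    deps (sov α) = sv α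
    deps zer = []
    deps (suc' a) = deps a
    deps (plus a b) = deps a ++ deps b
    deps (app g as) = depss as

    depss : {n : ℕ} → Vec (Term F ar ℕ) n → List ℕ
    depss [] = []
    depss (a ∷ as) = deps a ++ depss as

  mutual
    var∈deps : ∀ {j} (a : Term F ar ℕ) → OccVar j a → j ∈ deps a
    var∈deps (var j) here = here refl
    var∈deps (suc' a) (suc' o) = var∈deps a o
    var∈deps (plus a b) (plusˡ o) = ∈-++⁺ˡ (var∈deps a o)
    var∈deps (plus a b) (plusʳ o) = ∈-++⁺ʳ (deps a) (var∈deps b o)
    var∈deps (app g as) (app t∈ o) = var∈depss as t∈ o

    var∈depss : ∀ {n j t} (as : Vec (Term F ar ℕ) n) → t VM.∈ as → OccVar j t → j ∈ depss as
    var∈depss (a ∷ as) (VAny.here refl) o = ∈-++⁺ˡ (var∈deps a o)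
    var∈depss (a ∷ as) (VAny.there t∈) o = ∈-++⁺ʳ (deps a) (var∈depss as t∈ o)

  mutual
    sv⊆deps : ∀ {j α} (a : Term F ar ℕ) → OccSO α a → j ∈ sv α → j ∈ deps a
    sv⊆deps (sov α) here j∈ = j∈
    sv⊆deps (suc' a) (suc' o) j∈ = sv⊆deps a o j∈
    sv⊆deps (plus a b) (plusˡ o) j∈ = ∈-++⁺ˡ (sv⊆deps a o j∈)
    sv⊆deps (plus a b) (plusʳ o) j∈ = ∈-++⁺ʳ (deps a) (sv⊆deps b o j∈)
    sv⊆deps (app g as) (app t∈ o) j∈ = sv⊆depss as t∈ o j∈

    sv⊆depss : ∀ {n j α t} (as : Vec (Term F ar ℕ) n) → t VM.∈ as → OccSO α t → j ∈ sv α → j ∈ depss as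
    sv⊆depss (a ∷ as) (VAny.here refl) o j∈ = ∈-++⁺ˡ (sv⊆deps a o j∈)
    sv⊆depss (a ∷ as) (VAny.there t∈) o j∈ = ∈-++⁺ʳ (deps a) (sv⊆depss as t∈ o j∈)

  DependsOn : ℕ → Term F ar ℕ → Set
  DependsOn j a = OccVar j a ⊎ ∃ λ α → OccSO α a × j ∈ sv α

  DependsOn-map : ∀ {j a a'} → (∀ {i} → OccVar i a → OccVar i a') → (∀ {α} → OccSO α a → OccSO α a') →
    DependsOn j a → DependsOn j a'
  DependsOn-map f g (inj₁ o) = inj₁ (f o)
  DependsOn-map f g (inj₂ (α , o , j∈)) = inj₂ (α , g o , j∈)

  mutual
    deps-sound : ∀ {j} (a : Term F ar ℕ) → j ∈ deps a → DependsOn j a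
    deps-sound (var i) (here refl) = inj₁ here
    deps-sound (sov α) j∈ = inj₂ (α , here , j∈)
    deps-sound (suc' a) j∈ = DependsOn-map suc' suc' (deps-sound a j∈)
    deps-sound (plus a b) j∈ =
      [ DependsOn-map plusˡ plusˡ ∘ deps-sound a , DependsOn-map plusʳ plusʳ ∘ deps-sound b ]′ (∈-++⁻ (deps a) j∈)
    deps-sound (app g as) j∈ with VM.find (depss-sound as j∈)
    ... | t , t∈ , d = DependsOn-map (app t∈) (app t∈) d

    depss-sound : ∀ {n j} (as : Vec (Term F ar ℕ) n) → j ∈ depss as → VAny.Any (DependsOn j) as
    depss-sound (a ∷ as) j∈ =
      [ VAny.here ∘ deps-sound a , VAny.there ∘ depss-sound as ]′ (∈-++⁻ (deps a) j∈)

  skolemInterp : (J : Interp F ar) (κ : ℕ → Term F ar ⊥) → Interp (SkSym ar sv) (skAr ar sv)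
  skolemInterp J κ = record { fun = fun' ; mono = mono' }
    where
      fun' : (g : SkSym ar sv) → Vec ℕ (skAr ar sv g) → ℕ
      fun' (inj₁ g) v = fun J g v
      fun' (inj₂ α) v = eval J (assign (sv α) v) (κ α)

      mono' : ∀ g (u v : Vec ℕ (skAr ar sv g)) → Pointwise _≤_ u v → fun' g u ≤ fun' g v
      mono' (inj₁ g) u v u≤v = mono J g u v u≤v
      mono' (inj₂ α) u v u≤v = eval-mono J (κ α) (λ {j} _ → assign-mono (sv α) u≤v j)

  skolem-value : (J : Interp F ar) (κ : ℕ → Term F ar ⊥) (ρ : ℕ → ℕ) (α : ℕ) →
    eval (skolemInterp J κ) ρ (κsk sv α) ≡ eval J (restrict (sv α) ρ) (κ α)
  skolem-value J κ ρ α = cong (λ v → eval J (assign (sv α) v) (κ α)) (evals-vars (skolemInterp J κ) ρ (sv α))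

  skolemise-value : (J : Interp F ar) (κ : ℕ → Term F ar ⊥) (ρ : ℕ → ℕ) (a : Term F ar ℕ) →
    eval (skolemInterp J κ) ρ (skolemise a) ≡ evalSO J ρ (λ α → eval J (restrict (sv α) ρ) (κ α)) a
  skolemise-value J κ ρ a = begin
    eval J' ρ (skolemise a)                        ≡⟨ eval-subst J' ρ (κsk sv) (lift sv a) ⟩
    evalSO J' ρ (λ α → eval J' ρ (κsk sv α)) (lift sv a) ≡⟨ evalSO-lift sv (λ g v → refl) ρ _ a ⟩
    evalSO J ρ (λ α → eval J' ρ (κsk sv α)) a     ≡⟨ evalSO-congη J ρ a (skolem-value J κ ρ) ⟩
    evalSO J ρ (λ α → eval J (restrict (sv α) ρ) (κ α)) a ∎
    where
      open Relation.Binary.PropositionalEquality.≡-Reasoning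
      J' = skolemInterp J κ

module _ {F : Set} {ar : F → ℕ} (Φ : SOCP {F} {ar}) (sv : ℕ → List ℕ) (isv : IsSVEnum Φ sv) where

  liftΦ-≤ : ∀ {a' b'} (Ψ : SOCP {F} {ar}) → (a' ≤c b') ∈ liftΦ sv Ψ →
    (subst (κsk sv) a' , subst (κsk sv) b') ∈ sk sv Ψ
  liftΦ-≤ ((a ≤c b) ∷ Ψ) (here refl) = here refl
  liftΦ-≤ ((a ≤c b) ∷ Ψ) (there m) = there (liftΦ-≤ Ψ m)
  liftΦ-≤ ((i ↝̸ α) ∷ Ψ) (there m) = liftΦ-≤ Ψ m

  sk-origin : ∀ {a' b'} (Ψ : SOCP {F} {ar}) → (a' , b') ∈ sk sv Ψ →
    Σ (Term F ar ℕ) λ a → Σ (Term F ar ℕ) λ b →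
      (a ≤c b) ∈ Ψ × a' ≡ skolemise sv a × b' ≡ skolemise sv b
  sk-origin ((a ≤c b) ∷ Ψ) (here refl) = a , b , here refl , refl , refl
  sk-origin ((a ≤c b) ∷ Ψ) (there m) with sk-origin Ψ m
  ... | a₁ , b₁ , m₁ , eqa , eqb = a₁ , b₁ , there m₁ , eqa , eqb
  sk-origin ((i ↝̸ α) ∷ Ψ) m with sk-origin Ψ m
  ... | a₁ , b₁ , m₁ , eqa , eqb = a₁ , b₁ , there m₁ , eqa , eqb

  liftΦ-↝ : ∀ {i α} (Ψ : SOCP {F} {ar}) → (i ↝̸ α) ∈ liftΦ sv Ψ → (i ↝̸ α) ∈ Ψ
  liftΦ-↝ ((a ≤c b) ∷ Ψ) (there m) = there (liftΦ-↝ Ψ m)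
  liftΦ-↝ ((j ↝̸ β) ∷ Ψ) (here refl) = here refl
  liftΦ-↝ ((j ↝̸ β) ∷ Ψ) (there m) = there (liftΦ-↝ Ψ m)

  sv-sound : ∀ {i β} → i ∈ sv β → SV Φ i β
  sv-sound {i} {β} = Equivalence.to (proj₂ (isv β) i)

  sv-complete : ∀ {i β} → SV Φ i β → i ∈ sv β
  sv-complete {i} {β} = Equivalence.from (proj₂ (isv β) i)

  -- Part (1): the skolem terms satisfy the occurrence constraints because
  -- they only mention variables of SV(α).
  soundness : (J : Interp (SkSym ar sv) (skAr ar sv)) →
    IsModelFO J (sk sv Φ) → IsModelSO J (κsk sv) (liftΦ sv Φ)
  soundness J model = (λ a b m → model _ _ (liftΦ-≤ Φ m)) ,
    λ i α i↝̸α i∈κα → proj₂ (sv-sound (κsk-vars sv α i∈κα)) (liftΦ-↝ Φ i↝̸α)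

  deps⊆sv : ∀ {a b j β} → (a ≤c b) ∈ Φ → OccSO β b → j ∈ deps sv a → ¬ (j ↝̸ β) ∈ Φ → j ∈ sv β
  deps⊆sv {a} a≤b∈Φ β∈b j∈D j-allowed = sv-complete (closure (deps-sound sv a j∈D) , j-allowed)
    where
      closure : DependsOn sv _ a → SV' Φ _ _
      closure (inj₁ j∈a) = base a≤b∈Φ β∈b j∈a
      closure (inj₂ (α , α∈a , j∈svα)) = step a≤b∈Φ β∈b α∈a (proj₁ (sv-sound j∈svα))

  module _ (J : Interp F ar) (κ : ℕ → Term F ar ⊥) (model : IsModelSO J κ Φ) where

    skolemValue : (ℕ → ℕ) → ℕ → ℕ
    skolemValue ρ α = eval J (restrict (sv α) ρ) (κ α)

    skolem-constraint : ∀ {a b} → (a ≤c b) ∈ Φ → (ρ : ℕ → ℕ) →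
      evalSO J ρ (skolemValue ρ) a ≤ evalSO J ρ (skolemValue ρ) b
    skolem-constraint {a} {b} a≤b∈Φ ρ = begin
      evalSO J ρ (skolemValue ρ) a ≤⟨ evalSO-mono J a ρ≤σ-on-a skolem≤σ-on-a ⟩
      evalSO J σ ησ a              ≡⟨ eval-subst J σ κ a ⟨
      eval J σ (subst κ a)         ≤⟨ proj₁ model a b a≤b∈Φ σ ⟩
      eval J σ (subst κ b)         ≡⟨ eval-subst J σ κ b ⟩
      evalSO J σ ησ b              ≤⟨ evalSO-mono J b (λ {j} _ → restrict-≤ ρ (deps sv a) j) σ≤skolem-on-b ⟩
      evalSO J ρ (skolemValue ρ) b ∎
      where
        open ≤-Reasoning
        σ : ℕ → ℕ
        σ = restrict (deps sv a) ρ
        ησ : ℕ → ℕ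
        ησ α = eval J σ (κ α)

        ρ≤σ-on-a : ∀ {j} → OccVar j a → ρ j ≤ σ j
        ρ≤σ-on-a j∈a = ≤-reflexive (sym (restrict-∈ ρ (deps sv a) (var∈deps sv a j∈a)))

        skolem≤σ-on-a : ∀ {α} → OccSO α a → skolemValue ρ α ≤ ησ α
        skolem≤σ-on-a {α} α∈a = eval-mono J (κ α) (λ _ → restrict-⊆ ρ (sv α) (deps sv a) (sv⊆deps sv a α∈a))

        σ≤skolem-on-b : ∀ {β} → OccSO β b → ησ β ≤ skolemValue ρ β
        σ≤skolem-on-b {β} β∈b = eval-mono J (κ β)
          (λ {j} j∈κβ → restrict-⊆ ρ (deps sv a) (sv β) (λ j∈D → deps⊆sv a≤b∈Φ β∈b j∈D (λ j↝̸β → proj₂ model j β j↝̸β j∈κβ)))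

    completeness : IsModelFO (skolemInterp sv J κ) (sk sv Φ)
    completeness a' b' m ρ with sk-origin Φ m
    ... | a , b , a≤b∈Φ , refl , refl = begin
      eval J' ρ (skolemise sv a)   ≡⟨ skolemise-value sv J κ ρ a ⟩
      evalSO J ρ (skolemValue ρ) a ≤⟨ skolem-constraint a≤b∈Φ ρ ⟩
      evalSO J ρ (skolemValue ρ) b ≡⟨ skolemise-value sv J κ ρ b ⟨
      eval J' ρ (skolemise sv b)   ∎
      where
        open ≤-Reasoning
        J' = skolemInterp sv J κ

theorem6p4 : {F : Set} {ar : F → ℕ} (Φ : SOCP {F} {ar}) (sv : ℕ → List ℕ) →
    IsSVEnum Φ sv →
    ((J : Interp (SkSym ar sv) (skAr ar sv)) →
      IsModelFO J (sk sv Φ) → IsModelSO J (κsk sv) (liftΦ sv Φ))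
    ×
    ((J : Interp F ar) (κ : ℕ → Term F ar ⊥) →
      IsModelSO J κ Φ →
      Σ (Interp (SkSym ar sv) (skAr ar sv)) (λ J' → Extends sv J' J × IsModelFO J' (sk sv Φ)))
theorem6p4 Φ sv isv =
  soundness Φ sv isv ,
  λ J κ model → skolemInterp sv J κ , (λ g v → refl) , completeness Φ sv isv J κ model
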